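{- (i) Not every strictly affine combinatory algebra (SACA) is a strictly affine $\lambda$-algebra. (ii) Let $\mathcal A=(A,\cdot)$ be a SACA. Then the quotient $(A/\equiv_{\mathcal A},\ \cdot_{\equiv_{\mathcal A}})$ is a strictly affine $\lambda$-algebra. (iii) There exists a non-trivial SACA such that every quotient of it which is a strictly affine $\lambda$-algebra is trivial (i.e. not every non-trivial SACA can be quotiented to a non-trivial strictly affine $\lambda$-algebra).
   Context: A strictly affine combinatory algebra (SACA) is an applicative structure $(A,\cdot)$ (application written by juxtaposition, associating to the left) with distinguished elements $B,C,I,K$ such that for all $x,y,z\in A$: $Bxyz=x(yz)$, $Ix=x$, $Cxyz=(xz)y$, $Kxy=x$. $\mathcal T(\mathcal A)$ is the set of terms built from variables, the constants $B,C,I,K$ and a constant $c_a$ for each $a\in A$, closed under application; $[\![\cdot]\!]_{\mathcal A}$ is the natural interpretation of closed terms of $\mathcal T(\mathcal A)$ in $\mathcal A$ ($c_a\mapsto a$, combinators to the distinguished elements, application to $\cdot$). The strictly affine $\lambda$-calculus $\Lambda^A$: terms built from variables and constants by application and by abstraction $\lambda x.M$ allowed only when $x$ occurs free in $M$ at most once; $=_{\lambda^A}$ is the provable equality generated by $(\beta_A)$ $(\lambda x.M)N=M[N/x]$, $(\xi_A)$: from $M=N$ with $x$ free at most once in $M$ and in $N$ infer $\lambda x.M=\lambda x.N$, and the rules making $=$ a congruence. The translation $(\cdot)_{\lambda^A}$ from terms of $\mathcal T(\mathcal A)$ to $\Lambda^A$ is the homomorphism w.r.t. application that replaces $B$ by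 $\lambda xyz.x(yz)$, $C$ by $\lambda xyz.(xz)y$, $I$ by $\lambda x.x$, $K$ by $\lambda xy.x$ and leaves variables and other constants unchanged. A SACA $\mathcal A$ is a strictly affine $\lambda$-algebra if for all closed $M,N\in\mathcal T(\mathcal A)$, $(M)_{\lambda^A}=_{\lambda^A}(N)_{\lambda^A}$ implies $[\![M]\!]_{\mathcal A}=[\![N]\!]_{\mathcal A}$. For $a,b\in A$, $a\equiv_{\mathcal A} b$ iff there exist closed $M,N\in\mathcal T(\mathcal A)$ with $a=[\![M]\!]_{\mathcal A}$, $b=[\![N]\!]_{\mathcal A}$ and $(M)_{\lambda^A}=_{\lambda^A}(N)_{\lambda^A}$; $\cdot_{\equiv_{\mathcal A}}$ is the induced application on equivalence classes. -}

module Defs where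

open import Data.Nat using (ℕ; zero; suc; _+_; _≤_; _≡ᵇ_; _<ᵇ_; pred)
open import Data.Bool using (if_then_else_)
open import Data.Product using (Σ; _×_; _,_; ∃)
open import Data.Empty using (⊥)
open import Relation.Nullary using (¬_)
open import Relation.Binary.Structures using (IsEquivalence)
open import Relation.Binary.Construct.Closure.Equivalence as EqC using (EqClosure)
open import Relation.Binary.Construct.Closure.ReflexiveTransitive using (Star; ε; _◅_)
open import Relation.Binary.Construct.Closure.Symmetric using (SymClosure; fwd; bwd)

record SACA : Set₁ where
  infixl 9 _·_
  infix 4 _≈_
  field
    Carrier       : Set
    _≈_           : Carrier → Carrier → Set
    isEquivalence : IsEquivalence _≈_
    _·_           : Carrier → Carrier → Carrier
    ·-cong        : ∀ {a a′ b b′} → a ≈ a′ → b ≈ b′ → a · b ≈ a′ · b′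
    B C I K       : Carrier
    B-law         : ∀ x y z → B · x · y · z ≈ x · (y · z)
    I-law         : ∀ x → I · x ≈ x
    C-law         : ∀ x y z → C · x · y · z ≈ (x · z) · y
    K-law         : ∀ x y → K · x · y ≈ x

data Term (A : Set) : Set where
  var         : ℕ → Term A
  `B `C `I `K : Term A
  con         : A → Term A
  _∙_         : Term A → Term A → Term A

data Closed {A : Set} : Term A → Set where
  `B : Closed `B
  `C : Closed `C
  `I : Closed `I
  `K : Closed `K
  con : ∀ a → Closed (con a)
  _∙_ : ∀ {M N} → Closed M → Closed N → Closed (M ∙ N)

⟦_⟧ : (𝒜 : SACA) → {M : Term (SACA.Carrier 𝒜)} → Closed M → SACA.Carrier 𝒜
⟦ 𝒜 ⟧ `B = SACA.B 𝒜
⟦ 𝒜 ⟧ `C = SACA.C 𝒜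
⟦ 𝒜 ⟧ `I = SACA.I 𝒜
⟦ 𝒜 ⟧ `K = SACA.K 𝒜
⟦ 𝒜 ⟧ (con a) = a
⟦ 𝒜 ⟧ (p ∙ q) = SACA._·_ 𝒜 (⟦ 𝒜 ⟧ p) (⟦ 𝒜 ⟧ q)

data Λ (A : Set) : Set where
  var : ℕ → Λ A
  con : A → Λ A
  app : Λ A → Λ A → Λ A
  lam : Λ A → Λ A

module _ {A : Set} where

  occ : ℕ → Λ A → ℕ
  occ j (var k)   = if k ≡ᵇ j then 1 else 0
  occ j (con a)   = 0
  occ j (app M N) = occ j M + occ j N
  occ j (lam M)   = occ (suc j) M

  data Aff : Λ A → Set where
    var : ∀ k → Aff (var k)
    con : ∀ a → Aff (con a)
    app : ∀ {M N} → Aff M → Aff N → Aff (app M N)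
    lam : ∀ {M} → Aff M → occ 0 M ≤ 1 → Aff (lam M)

  shift : ℕ → Λ A → Λ A
  shift c (var k)   = if k <ᵇ c then var k else var (suc k)
  shift c (con a)   = con a
  shift c (app M N) = app (shift c M) (shift c N)
  shift c (lam M)   = lam (shift (suc c) M)

  -- capture-avoiding substitution of N for index j (indices above j drop by one)
  subst : ℕ → Λ A → Λ A → Λ A
  subst j N (var k)   = if k ≡ᵇ j then N else (if k <ᵇ j then var k else var (pred k))
  subst j N (con a)   = con a
  subst j N (app M P) = app (subst j N M) (subst j N P)
  subst j N (lam M)   = lam (subst (suc j) (shift 0 N) M)

  infix 4 _=λ_
  data _=λ_ : Λ A → Λ A → Set where
    βA    : ∀ {M N} → Aff (lam M) → Aff N → app (lam M) N =λ subst 0 N M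
    ξA    : ∀ {M N} → M =λ N → occ 0 M ≤ 1 → occ 0 N ≤ 1 → lam M =λ lam N
    refl  : ∀ {M} → Aff M → M =λ M
    sym   : ∀ {M N} → M =λ N → N =λ M
    trans : ∀ {M N P} → M =λ N → N =λ P → M =λ P
    app-cong : ∀ {M M′ N N′} → M =λ M′ → N =λ N′ → app M N =λ app M′ N′

  toΛ : Term A → Λ A
  toΛ (var n) = var n
  toΛ `B = lam (lam (lam (app (var 2) (app (var 1) (var 0)))))
  toΛ `C = lam (lam (lam (app (app (var 2) (var 0)) (var 1))))
  toΛ `I = lam (var 0)
  toΛ `K = lam (lam (var 1))
  toΛ (con a) = con a
  toΛ (M ∙ N) = app (toΛ M) (toΛ N)

IsSALambdaAlgebra : SACA → Set
IsSALambdaAlgebra 𝒜 =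
  ∀ {M N : Term Carrier} (cM : Closed M) (cN : Closed N) →
  toΛ M =λ toΛ N → ⟦ 𝒜 ⟧ cM ≈ ⟦ 𝒜 ⟧ cN
  where open SACA 𝒜

Trivial : SACA → Set
Trivial 𝒜 = ∀ a b → a ≈ b  where open SACA 𝒜

NonTrivial : SACA → Set
NonTrivial 𝒜 = Σ Carrier λ a → Σ Carrier λ b → ¬ (a ≈ b)  where open SACA 𝒜

module _ (𝒜 : SACA) where
  open SACA 𝒜

  record IsSACACongruence (R : Carrier → Carrier → Set) : Set where
    field
      isEquiv : IsEquivalence R
      ≈⊆R     : ∀ {a b} → a ≈ b → R a b
      cong    : ∀ {a a′ b b′} → R a a′ → R b b′ → R (a · b) (a′ · b′)

  quotient : (R : Carrier → Carrier → Set) → IsSACACongruence R → SACA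
  quotient R c = record
    { Carrier = Carrier ; _≈_ = R ; isEquivalence = isEquiv ; _·_ = _·_
    ; ·-cong = cong ; B = B ; C = C ; I = I ; K = K
    ; B-law = λ x y z → ≈⊆R (B-law x y z)
    ; I-law = λ x → ≈⊆R (I-law x)
    ; C-law = λ x y z → ≈⊆R (C-law x y z)
    ; K-law = λ x y → ≈⊆R (K-law x y) }
    where open IsSACACongruence c

  _≡𝒜_ : Carrier → Carrier → Set
  a ≡𝒜 b = Σ (Term Carrier) λ M → Σ (Term Carrier) λ N →
           Σ (Closed M) λ cM → Σ (Closed N) λ cN →
           (a ≈ ⟦ 𝒜 ⟧ cM) × (b ≈ ⟦ 𝒜 ⟧ cN) × (toΛ M =λ toΛ N)

  private
    module E = IsEquivalence isEquivalence

    aff-toΛ : ∀ {M : Term Carrier} → Closed M → Aff (toΛ M)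
    aff-toΛ `B = lam (lam (lam (app (var 2) (app (var 1) (var 0))) (Data.Nat.s≤s Data.Nat.z≤n)) (Data.Nat.s≤s Data.Nat.z≤n)) (Data.Nat.s≤s Data.Nat.z≤n)
    aff-toΛ `C = lam (lam (lam (app (app (var 2) (var 0)) (var 1)) (Data.Nat.s≤s Data.Nat.z≤n)) (Data.Nat.s≤s Data.Nat.z≤n)) (Data.Nat.s≤s Data.Nat.z≤n)
    aff-toΛ `I = lam (var 0) (Data.Nat.s≤s Data.Nat.z≤n)
    aff-toΛ `K = lam (lam (var 1) Data.Nat.z≤n) (Data.Nat.s≤s Data.Nat.z≤n)
    aff-toΛ (con a) = con a
    aff-toΛ (p ∙ q) = app (aff-toΛ p) (aff-toΛ q)

    ≡-refl : ∀ {a b} → a ≈ b → a ≡𝒜 b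
    ≡-refl {a} {b} e = con a , con a , con a , con a , E.refl , E.sym e , refl (con a)

    ≡-sym : ∀ {a b} → a ≡𝒜 b → b ≡𝒜 a
    ≡-sym (M , N , cM , cN , p , q , r) = N , M , cN , cM , q , p , sym r

    ≡-app : ∀ {a a′ b b′} → a ≡𝒜 a′ → b ≡𝒜 b′ → (a · b) ≡𝒜 (a′ · b′)
    ≡-app (M , N , cM , cN , p , q , r) (M′ , N′ , cM′ , cN′ , p′ , q′ , r′) =
      M ∙ M′ , N ∙ N′ , cM ∙ cM′ , cN ∙ cN′ , ·-cong p p′ , ·-cong q q′ , app-cong r r′

    Q = EqClosure _≡𝒜_

    sc-sym : ∀ {a b} → SymClosure _≡𝒜_ a b → a ≡𝒜 b
    sc-sym (fwd x) = x
    sc-sym (bwd x) = ≡-sym x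

    congL : ∀ {a a′} b → Q a a′ → Q (a · b) (a′ · b)
    congL b ε = ε
    congL b (x ◅ xs) = fwd (≡-app (sc-sym x) (≡-refl E.refl)) ◅ congL b xs

    congR : ∀ a {b b′} → Q b b′ → Q (a · b) (a · b′)
    congR a ε = ε
    congR a (x ◅ xs) = fwd (≡-app (≡-refl E.refl) (sc-sym x)) ◅ congR a xs

    Q-cong : ∀ {a a′ b b′} → Q a a′ → Q b b′ → Q (a · b) (a′ · b′)
    Q-cong {a′ = a′} {b = b} p q =
      Relation.Binary.Construct.Closure.ReflexiveTransitive._◅◅_ (congL b p) (congR a′ q)

  -- ≡_𝒜 closed under equivalence (it is reflexive, symmetric and compatible
  -- with application; only transitivity has to be added)
  ≡𝒜-congruence : IsSACACongruence (EqClosure _≡𝒜_)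
  ≡𝒜-congruence = record
    { isEquiv = EqC.isEquivalence _≡𝒜_
    ; ≈⊆R = λ e → fwd (≡-refl e) ◅ ε
    ; cong = Q-cong }

  quotient≡ : SACA
  quotient≡ = quotient (EqClosure _≡𝒜_) ≡𝒜-congruence

{-# OPTIONS --safe #-}
module Submission where

-- Add to combinatory logic a constant F with F(CK) → K and F(KI) → CK.
-- Parallel reduction is still confluent, so K and CK stay distinct. But CK
-- and KI are equal as strictly affine λ-terms, so in every quotient that is a
-- strictly affine λ-algebra K = F(CK) = F(KI) = CK, and then
-- x = Kxy = CKxy = Kyx = y. Quotienting by ≡𝒜 instead makes λ-equal terms
-- equal by construction.

open import Defs
open import Data.Nat using (_≤_; z≤n; s≤s)
open import Data.Product using (Σ; _×_; _,_)
open import Relation.Nullary using (¬_)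
open import Relation.Binary.Bundles using (PartialSetoid; Setoid)
open import Relation.Binary.PropositionalEquality as ≡ using (_≡_)
open import Relation.Binary.Structures using (IsEquivalence)
open import Relation.Binary.Construct.Closure.Equivalence as EqC using (EqClosure)
open import Relation.Binary.Construct.Closure.ReflexiveTransitive using (Star; ε; _◅_; _◅◅_)
open import Relation.Binary.Construct.Closure.Symmetric using (fwd; bwd)

module _ {A : Set} where

  =λ-partialSetoid : PartialSetoid _ _
  =λ-partialSetoid = record
    { Carrier = Λ A
    ; _≈_ = _=λ_
    ; isPartialEquivalence = record { sym = sym ; trans = trans }
    }

  CK=λKI : toΛ {A} (`C ∙ `K) =λ toΛ (`K ∙ `I)
  CK=λKI = begin
    app Cλ Kλ                                       ≈⟨ βA affC affK ⟩
    lam (lam (app (app Kλ (var 0)) (var 1)))        ≈⟨ ξA (ξA body s≤1 s≤1) s≤1 z≤n ⟩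
    lam (lam (var 0))                               ≈⟨ βA affK affI ⟨
    app Kλ Iλ                                       ∎
    where
    open import Relation.Binary.Reasoning.PartialSetoid =λ-partialSetoid
    Cλ Kλ Iλ : Λ A
    Cλ = toΛ `C
    Kλ = toΛ `K
    Iλ = toΛ `I
    s≤1 : 1 ≤ 1
    s≤1 = s≤s z≤n
    affC : Aff Cλ
    affC = lam (lam (lam (app (app (var 2) (var 0)) (var 1)) s≤1) s≤1) s≤1
    affK : Aff Kλ
    affK = lam (lam (var 1) z≤n) s≤1
    affI : Aff Iλ
    affI = lam (var 0) s≤1
    body : app (app Kλ (var 0)) (var 1) =λ var 0
    body = trans (app-cong (βA affK (var 0)) (refl (var 1))) (βA (lam (var 1) z≤n) (var 1))

module _ (𝒜 : SACA) where
  open SACA 𝒜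
  open IsEquivalence isEquivalence using () renaming (refl to ≈-refl)

  setoid : Setoid _ _
  setoid = record { isEquivalence = isEquivalence }

  open import Relation.Binary.Reasoning.Setoid setoid

  K≈CK⇒trivial : K ≈ C · K → Trivial 𝒜
  K≈CK⇒trivial K≈CK x y = begin
    x              ≈⟨ K-law x y ⟨
    K · x · y      ≈⟨ ·-cong (·-cong K≈CK ≈-refl) ≈-refl ⟩
    C · K · x · y  ≈⟨ C-law K x y ⟩
    K · y · x      ≈⟨ K-law y x ⟩
    y              ∎

  λAlgebra⇒CK≈KI : IsSALambdaAlgebra 𝒜 → C · K ≈ K · I
  λAlgebra⇒CK≈KI isλ = isλ (`C ∙ `K) (`K ∙ `I) CK=λKI

  λAlgebra⇒trivial : IsSALambdaAlgebra 𝒜 →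
                     ∀ f → f · (C · K) ≈ K → f · (K · I) ≈ C · K → Trivial 𝒜
  λAlgebra⇒trivial isλ f fCK≈K fKI≈CK = K≈CK⇒trivial (begin
    K              ≈⟨ fCK≈K ⟨
    f · (C · K)    ≈⟨ ·-cong ≈-refl (λAlgebra⇒CK≈KI isλ) ⟩
    f · (K · I)    ≈⟨ fKI≈CK ⟩
    C · K          ∎)

⟦⟧-quotient : ∀ 𝒜 R c {M} (cM : Closed M) → ⟦ quotient 𝒜 R c ⟧ cM ≡ ⟦ 𝒜 ⟧ cM
⟦⟧-quotient 𝒜 R c `B      = ≡.refl
⟦⟧-quotient 𝒜 R c `C      = ≡.refl
⟦⟧-quotient 𝒜 R c `I      = ≡.refl
⟦⟧-quotient 𝒜 R c `K      = ≡.refl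
⟦⟧-quotient 𝒜 R c (con a) = ≡.refl
⟦⟧-quotient 𝒜 R c (p ∙ q) =
  ≡.cong₂ (SACA._·_ 𝒜) (⟦⟧-quotient 𝒜 R c p) (⟦⟧-quotient 𝒜 R c q)

quotient≡-isλAlgebra : ∀ 𝒜 → IsSALambdaAlgebra (quotient≡ 𝒜)
quotient≡-isλAlgebra 𝒜 {M} {N} cM cN M=λN =
  fwd (M , N , cM , cN , ⟦⟧-quotient≡ cM , ⟦⟧-quotient≡ cN , M=λN) ◅ ε
  where
  open IsEquivalence (SACA.isEquivalence 𝒜) using (reflexive)
  ⟦⟧-quotient≡ : ∀ {P} (cP : Closed P) → SACA._≈_ 𝒜 (⟦ quotient≡ 𝒜 ⟧ cP) (⟦ 𝒜 ⟧ cP)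
  ⟦⟧-quotient≡ cP = reflexive (⟦⟧-quotient 𝒜 _ (≡𝒜-congruence 𝒜) cP)

infixl 9 _·_
data CLF : Set where
  B C I K F : CLF
  _·_ : CLF → CLF → CLF

infix 4 _⇒_
data _⇒_ : CLF → CLF → Set where
  rB : B ⇒ B
  rC : C ⇒ C
  rI : I ⇒ I
  rK : K ⇒ K
  rF : F ⇒ F
  ap : ∀ {M M′ N N′} → M ⇒ M′ → N ⇒ N′ → M · N ⇒ M′ · N′
  I-red : ∀ {x x′} → x ⇒ x′ → I · x ⇒ x′
  K-red : ∀ {x x′ y} → x ⇒ x′ → K · x · y ⇒ x′
  B-red : ∀ {x x′ y y′ z z′} → x ⇒ x′ → y ⇒ y′ → z ⇒ z′ → B · x · y · z ⇒ x′ · (y′ · z′)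
  C-red : ∀ {x x′ y y′ z z′} → x ⇒ x′ → y ⇒ y′ → z ⇒ z′ → C · x · y · z ⇒ x′ · z′ · y′
  F-CK : F · (C · K) ⇒ K
  F-KI : F · (K · I) ⇒ C · K

⇒-refl : ∀ M → M ⇒ M
⇒-refl B       = rB
⇒-refl C       = rC
⇒-refl I       = rI
⇒-refl K       = rK
⇒-refl F       = rF
⇒-refl (M · N) = ap (⇒-refl M) (⇒-refl N)

Joinable : (CLF → CLF → Set) → CLF → CLF → Set
Joinable _⟶_ M N = Σ CLF λ P → (M ⟶ P) × (N ⟶ P)

⇒-diamond : ∀ {M N₁ N₂} → M ⇒ N₁ → M ⇒ N₂ → Joinable _⇒_ N₁ N₂
⇒-diamond rB rB = B , rB , rB
⇒-diamond rC rC = C , rC , rC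
⇒-diamond rI rI = I , rI , rI
⇒-diamond rK rK = K , rK , rK
⇒-diamond rF rF = F , rF , rF
⇒-diamond (ap p q) (ap p′ q′) with ⇒-diamond p p′ | ⇒-diamond q q′
... | X , a , b | Y , c , d = X · Y , ap a c , ap b d
⇒-diamond (ap rI p) (I-red p′) with ⇒-diamond p p′
... | X , a , b = X , I-red a , b
⇒-diamond (I-red p) (ap rI p′) with ⇒-diamond p p′
... | X , a , b = X , a , I-red b
⇒-diamond (I-red p) (I-red p′) = ⇒-diamond p p′
⇒-diamond (ap (ap rK p) _) (K-red p′) with ⇒-diamond p p′
... | X , a , b = X , K-red a , b
⇒-diamond (K-red p) (ap (ap rK p′) _) with ⇒-diamond p p′
... | X , a , b = X , a , K-red b
⇒-diamond (K-red p) (K-red p′) = ⇒-diamond p p′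
⇒-diamond (ap (ap (ap rB p) q) r) (B-red p′ q′ r′)
  with ⇒-diamond p p′ | ⇒-diamond q q′ | ⇒-diamond r r′
... | X , a , b | Y , c , d | Z , e , f = X · (Y · Z) , B-red a c e , ap b (ap d f)
⇒-diamond (B-red p q r) (ap (ap (ap rB p′) q′) r′)
  with ⇒-diamond p p′ | ⇒-diamond q q′ | ⇒-diamond r r′
... | X , a , b | Y , c , d | Z , e , f = X · (Y · Z) , ap a (ap c e) , B-red b d f
⇒-diamond (B-red p q r) (B-red p′ q′ r′)
  with ⇒-diamond p p′ | ⇒-diamond q q′ | ⇒-diamond r r′
... | X , a , b | Y , c , d | Z , e , f = X · (Y · Z) , ap a (ap c e) , ap b (ap d f)
⇒-diamond (ap (ap (ap rC p) q) r) (C-red p′ q′ r′)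
  with ⇒-diamond p p′ | ⇒-diamond q q′ | ⇒-diamond r r′
... | X , a , b | Y , c , d | Z , e , f = X · Z · Y , C-red a c e , ap (ap b f) d
⇒-diamond (C-red p q r) (ap (ap (ap rC p′) q′) r′)
  with ⇒-diamond p p′ | ⇒-diamond q q′ | ⇒-diamond r r′
... | X , a , b | Y , c , d | Z , e , f = X · Z · Y , ap (ap a e) c , C-red b d f
⇒-diamond (C-red p q r) (C-red p′ q′ r′)
  with ⇒-diamond p p′ | ⇒-diamond q q′ | ⇒-diamond r r′
... | X , a , b | Y , c , d | Z , e , f = X · Z · Y , ap (ap a e) c , ap (ap b f) d
⇒-diamond (ap rF (ap rC rK)) F-CK = K , F-CK , rK
⇒-diamond F-CK (ap rF (ap rC rK)) = K , rK , F-CK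
⇒-diamond F-CK F-CK = K , rK , rK
⇒-diamond (ap rF (ap rK rI)) F-KI = C · K , F-KI , ap rC rK
⇒-diamond F-KI (ap rF (ap rK rI)) = C · K , ap rC rK , F-KI
⇒-diamond F-KI F-KI = C · K , ap rC rK , ap rC rK

⇒-strip : ∀ {M N₁ N₂} → M ⇒ N₁ → Star _⇒_ M N₂ → Σ CLF λ P → Star _⇒_ N₁ P × N₂ ⇒ P
⇒-strip {N₁ = N₁} s ε = N₁ , ε , s
⇒-strip s (t ◅ ts) with ⇒-diamond s t
... | X , a , b with ⇒-strip b ts
... | P , c , d = P , a ◅ c , d

infix 4 _≈_
_≈_ : CLF → CLF → Set
_≈_ = EqClosure _⇒_

⇒⊆≈ : ∀ {M N} → M ⇒ N → M ≈ N
⇒⊆≈ s = fwd s ◅ ε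

≈-cong : ∀ {M M′ N N′} → M ≈ M′ → N ≈ N′ → M · N ≈ M′ · N′
≈-cong {M′ = M′} {N = N} p q =
  EqC.gmap (_· N) (λ s → ap s (⇒-refl N)) p ◅◅ EqC.gmap (M′ ·_) (ap (⇒-refl M′)) q

church-rosser : ∀ {M N} → M ≈ N → Joinable (Star _⇒_) M N
church-rosser {M} ε = M , ε , ε
church-rosser (fwd s ◅ ss) with church-rosser ss
... | P , a , b = P , s ◅ a , b
church-rosser (bwd s ◅ ss) with church-rosser ss
... | P , a , b with ⇒-strip s a
... | Q , c , d = Q , c , b ◅◅ (d ◅ ε)

K-⇒* : ∀ {X} → Star _⇒_ K X → X ≡ K
K-⇒* ε         = ≡.refl
K-⇒* (rK ◅ ss) = K-⇒* ss

CK-⇒* : ∀ {X} → Star _⇒_ (C · K) X → X ≡ C · K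
CK-⇒* ε                 = ≡.refl
CK-⇒* (ap rC rK ◅ ss) = CK-⇒* ss

K≉CK : ¬ K ≈ C · K
K≉CK K≈CK with church-rosser K≈CK
... | P , K⇒*P , CK⇒*P with ≡.trans (≡.sym (K-⇒* K⇒*P)) (CK-⇒* CK⇒*P)
... | ()

termModel : SACA
termModel = record
  { Carrier = CLF ; _≈_ = _≈_ ; isEquivalence = EqC.isEquivalence _⇒_
  ; _·_ = _·_ ; ·-cong = ≈-cong
  ; B = B ; C = C ; I = I ; K = K
  ; B-law = λ x y z → ⇒⊆≈ (B-red (⇒-refl x) (⇒-refl y) (⇒-refl z))
  ; I-law = λ x → ⇒⊆≈ (I-red (⇒-refl x))
  ; C-law = λ x y z → ⇒⊆≈ (C-red (⇒-refl x) (⇒-refl y) (⇒-refl z))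
  ; K-law = λ x y → ⇒⊆≈ (K-red (⇒-refl x))
  }

termModel-¬λAlgebra : ¬ IsSALambdaAlgebra termModel
termModel-¬λAlgebra isλ =
  K≉CK (λAlgebra⇒trivial termModel isλ F (⇒⊆≈ F-CK) (⇒⊆≈ F-KI) K (C · K))

termModel-λAlgebra-quotient-trivial :
  ∀ R (c : IsSACACongruence termModel R) →
  IsSALambdaAlgebra (quotient termModel R c) → Trivial (quotient termModel R c)
termModel-λAlgebra-quotient-trivial R c isλ =
  λAlgebra⇒trivial (quotient termModel R c) isλ F (≈⊆R (⇒⊆≈ F-CK)) (≈⊆R (⇒⊆≈ F-KI))
  where open IsSACACongruence c

mainTheorem3 :
    (Σ SACA λ 𝒜 → ¬ IsSALambdaAlgebra 𝒜)
    × (∀ (𝒜 : SACA) → IsSALambdaAlgebra (quotient≡ 𝒜))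
    × (Σ SACA λ 𝒜 → NonTrivial 𝒜 ×
         (∀ (R : SACA.Carrier 𝒜 → SACA.Carrier 𝒜 → Set) (c : IsSACACongruence 𝒜 R) →
            IsSALambdaAlgebra (quotient 𝒜 R c) → Trivial (quotient 𝒜 R c)))
mainTheorem3 =
    (termModel , termModel-¬λAlgebra)
  , quotient≡-isλAlgebra
  , (termModel , (K , C · K , K≉CK) , termModel-λAlgebra-quotient-trivial)
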